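{- Let $G=(V,E)$ be a planar biconnected graph with $\deg(v) \geq 3$ for every $v \in V$. Then in the SPQR-tree of $G$ there exists at least one Q-node that is adjacent to a P-node or an R-node.
   Context: The SPQR-tree $\mathcal{T}$ of a biconnected graph $G$ (Di Battista–Tamassia) represents the decomposition of $G$ into triconnected components. Each node $\mu$ has a skeleton graph: for a Q-node it consists of two parallel edges between the same two vertices, one of which is a real edge of $G$ (there is one Q-node per edge of $G$, and Q-nodes are exactly the leaves of $\mathcal{T}$); for an S-node it is a simple cycle of length at least three; for a P-node it is a bundle of at least three parallel edges between two vertices; for an R-node it is a simple triconnected graph. Non-real skeleton edges are virtual, and each virtual edge corresponds to an adjacent node of $\mathcal{T}$ (and a twin virtual edge in its skeleton). No two S-nodes and no two P-nodes are adjacent in $\mathcal{T}$. -}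

module Defs where

open import Data.Nat using (ℕ; zero; suc; _+_; _*_; _≤_; _<?_; _≤ᵇ_)
open import Data.Fin using (Fin; toℕ; fromℕ<)
open import Data.Fin.Properties using (_≟_)
open import Data.Bool using (Bool; true; false; if_then_else_; _∧_; _∨_; not)
open import Data.Product using (Σ; _×_; _,_; proj₁; proj₂; ∃; ∃-syntax)
open import Data.Sum using (_⊎_)
open import Data.Maybe using (Maybe; just; nothing)
open import Data.Empty using (⊥)
open import Relation.Binary.PropositionalEquality using (_≡_; _≢_)
open import Relation.Nullary using (¬_; does; yes; no)
open import Relation.Binary.Construct.Closure.Equivalence using (EqClosure)

count : ∀ {n} → (Fin n → Bool) → ℕ
count {zero}  P = 0
count {suc n} P = (if P Data.Fin.zero then 1 else 0) + count (λ i → P (Data.Fin.suc i))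

allBelow : ℕ → (ℕ → Bool) → Bool
allBelow zero    P = true
allBelow (suc n) P = allBelow n P ∧ P n

iter : ∀ {A : Set} → ℕ → (A → A) → A → A
iter zero    f x = x
iter (suc k) f x = f (iter k f x)

Injective : ∀ {A B : Set} → (A → B) → Set
Injective f = ∀ x y → f x ≡ f y → x ≡ y

Bijective : ∀ {A B : Set} → (A → B) → Set
Bijective {B = B} f = Injective f × (∀ (y : B) → ∃[ x ] (f x ≡ y))

sucWrap : ∀ {n} → Fin n → Fin n
sucWrap {suc n} i with toℕ i <? n
... | yes p = Data.Fin.suc (fromℕ< p)
... | no _  = Data.Fin.zero

SamePair : ∀ {A : Set} → A × A → A × A → Set
SamePair (a , b) (c , d) = (a ≡ c × b ≡ d) ⊎ (a ≡ d × b ≡ c)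

-- Finite undirected multigraphs: vertices Fin nV, edges Fin nE,
-- each edge with its (unordered) pair of end vertices.

record MGraph : Set where
  field
    nV nE : ℕ
    ends  : Fin nE → Fin nV × Fin nV
open MGraph public

module _ (G : MGraph) where

  Incident : Fin (nE G) → Fin (nV G) → Set
  Incident e v = proj₁ (ends G e) ≡ v ⊎ proj₂ (ends G e) ≡ v

  incidentᵇ : Fin (nE G) → Fin (nV G) → Bool
  incidentᵇ e v = does (proj₁ (ends G e) ≟ v) ∨ does (proj₂ (ends G e) ≟ v)

  -- degree = number of incident edges (no loops occur in the graphs used)
  degree : Fin (nV G) → ℕ
  degree v = count (λ e → incidentᵇ e v)

  Loopless : Set
  Loopless = ∀ e → proj₁ (ends G e) ≢ proj₂ (ends G e)

  Simple : Set
  Simple = Loopless × (∀ e e' → SamePair (ends G e) (ends G e') → e ≡ e')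

  Adjacent : Fin (nV G) → Fin (nV G) → Set
  Adjacent u v = ∃[ e ] SamePair (ends G e) (u , v)

  -- walks avoiding a removed vertex set Rm (start vertex not checked)
  data Reach (Rm : Fin (nV G) → Set) : Fin (nV G) → Fin (nV G) → Set where
    here : ∀ {u} → Reach Rm u u
    step : ∀ {u v w} → Adjacent u v → ¬ Rm v → Reach Rm v w → Reach Rm u w

  ConnectedAvoiding : (Fin (nV G) → Set) → Set
  ConnectedAvoiding Rm = ∀ u v → ¬ Rm u → ¬ Rm v → Reach Rm u v

  Connected : Set
  Connected = ConnectedAvoiding (λ _ → ⊥)

  Biconnected : Set
  Biconnected = 3 ≤ nV G × Connected × (∀ x → ConnectedAvoiding (λ z → z ≡ x))

  Triconnected : Set
  Triconnected = 4 ≤ nV G × Simple × Connected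
               × (∀ x y → ConnectedAvoiding (λ z → z ≡ x ⊎ z ≡ y))

  IsCycle : Set
  IsCycle = 3 ≤ nV G ×
    Σ (Fin (nV G) → Fin (nV G)) λ π → Bijective π ×
    Σ (Fin (nV G) → Fin (nE G)) λ τ → Bijective τ ×
    (∀ i → SamePair (ends G (τ i)) (π i , π (sucWrap i)))

  -- Planarity via combinatorial embeddings (rotation systems):
  -- a connected graph is planar iff it has a rotation system whose
  -- number of faces f satisfies Euler's formula  V - E + f = 2.

  Dart : Set
  Dart = Fin (nE G) × Bool

  tail : Dart → Fin (nV G)
  tail (e , false) = proj₁ (ends G e)
  tail (e , true)  = proj₂ (ends G e)

  flip : Dart → Dart
  flip (e , b) = (e , not b)

  dartKey : Dart → ℕ
  dartKey (e , b) = 2 * toℕ e + (if b then 1 else 0)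

  countDarts : (Dart → Bool) → ℕ
  countDarts P = count (λ e → P (e , false)) + count (λ e → P (e , true))

  record Rotation : Set where
    field
      σ σ⁻¹     : Dart → Dart
      σ-inv₁    : ∀ d → σ (σ⁻¹ d) ≡ d
      σ-inv₂    : ∀ d → σ⁻¹ (σ d) ≡ d
      σ-tail    : ∀ d → tail (σ d) ≡ tail d
      σ-cyclic  : ∀ d d' → tail d ≡ tail d' → ∃[ k ] (iter k σ d ≡ d')

    faceStep : Dart → Dart
    faceStep d = σ (flip d)

    -- d is the least dart (by dartKey) of its face orbit; orbits have
    -- size ≤ number of darts = 2 nE, so checking k < 2 nE suffices
    isFaceRep : Dart → Bool
    isFaceRep d = allBelow (2 * nE G) (λ k → dartKey d ≤ᵇ dartKey (iter k faceStep d))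

    faces : ℕ
    faces = countDarts isFaceRep

  -- (Euler criterion; appropriate for connected graphs, which is the case here)
  Planar : Set
  Planar = Σ Rotation λ ρ → nV G + Rotation.faces ρ ≡ nE G + 2

data NodeType : Set where
  S P Q R : NodeType

record Decomp (G : MGraph) : Set where
  field
    tree  : MGraph
    type  : Fin (nV tree) → NodeType
    skel  : Fin (nV tree) → MGraph
    -- nothing = real edge; just τ = virtual edge for tree edge τ
    kind  : (μ : Fin (nV tree)) → Fin (nE (skel μ)) → Maybe (Fin (nE tree))
    vmap  : (μ : Fin (nV tree)) → Fin (nV (skel μ)) → Fin (nV G)
    rmap  : (μ : Fin (nV tree)) (e : Fin (nE (skel μ))) → kind μ e ≡ nothing → Fin (nE G)

module _ {G : MGraph} (D : Decomp G) where
  open Decomp D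

  Node : Set
  Node = Fin (nV tree)

  SkelVertex : Set
  SkelVertex = Σ Node λ μ → Fin (nV (skel μ))

  SkelEdge : Set
  SkelEdge = Σ Node λ μ → Fin (nE (skel μ))

  vmap' : SkelVertex → Fin (nV G)
  vmap' (μ , x) = vmap μ x

  vends : (μ : Node) → Fin (nE (skel μ)) → Fin (nV G) × Fin (nV G)
  vends μ e = vmap μ (proj₁ (ends (skel μ) e)) , vmap μ (proj₂ (ends (skel μ) e))

  AllVirtual : Node → Set
  AllVirtual μ = ∀ e → kind μ e ≢ nothing

  SkelOK : Node → NodeType → Set
  SkelOK μ Q = nV (skel μ) ≡ 2 × nE (skel μ) ≡ 2 × Loopless (skel μ)
             × ∃[ e ] (kind μ e ≡ nothing × (∀ e' → kind μ e' ≡ nothing → e' ≡ e))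
  SkelOK μ S = IsCycle (skel μ) × AllVirtual μ
  SkelOK μ P = nV (skel μ) ≡ 2 × 3 ≤ nE (skel μ) × Loopless (skel μ) × AllVirtual μ
  SkelOK μ R = Triconnected (skel μ) × AllVirtual μ

  -- one gluing step: endpoints of twin virtual edges that are identified
  Glue : SkelVertex → SkelVertex → Set
  Glue (μ , x) (ν , y) = Σ (Fin (nE tree)) λ τ →
    ends tree τ ≡ (μ , ν) ×
    Σ (Fin (nE (skel μ))) λ e → Σ (Fin (nE (skel ν))) λ e' →
      kind μ e ≡ just τ × kind ν e' ≡ just τ ×
      Incident (skel μ) e x × Incident (skel ν) e' y × vmap μ x ≡ vmap ν y

  record IsSPQRTree : Set where
    field
      treeConn   : Connected tree
      treeEdges  : suc (nE tree) ≡ nV tree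
      skelOK     : ∀ μ → SkelOK μ (type μ)
      kindInc    : ∀ μ e τ → kind μ e ≡ just τ → Incident tree τ μ
      kindUnique : ∀ τ μ → Incident tree τ μ →
                     ∃[ e ] (kind μ e ≡ just τ × (∀ e' → kind μ e' ≡ just τ → e' ≡ e))
      vmapInj    : ∀ μ → Injective (vmap μ)
      twinEnds   : ∀ τ e e' → kind (proj₁ (ends tree τ)) e ≡ just τ
                            → kind (proj₂ (ends tree τ)) e' ≡ just τ
                            → SamePair (vends _ e) (vends _ e')
      realEnds   : ∀ μ e (p : kind μ e ≡ nothing) → SamePair (vends μ e) (ends G (rmap μ e p))
      realInj    : ∀ μ e p ν e' q → rmap μ e p ≡ rmap ν e' q → _≡_ {A = SkelEdge} (μ , e) (ν , e')
      realSurj   : ∀ g → ∃[ μ ] ∃[ e ] Σ (kind μ e ≡ nothing) λ p → rmap μ e p ≡ g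
      -- vertices of G are exactly the classes of skeleton vertices under gluing
      vmapSurj   : ∀ v → ∃[ a ] (vmap' a ≡ v)
      vmapGlue   : ∀ a b → vmap' a ≡ vmap' b → EqClosure Glue a b
      noSS       : ∀ τ → ¬ (type (proj₁ (ends tree τ)) ≡ S × type (proj₂ (ends tree τ)) ≡ S)
      noPP       : ∀ τ → ¬ (type (proj₁ (ends tree τ)) ≡ P × type (proj₂ (ends tree τ)) ≡ P)

-- A vertex of G all of whose skeleton copies lie in nodes contributing only two real edges has
-- degree at most 2.  Hence no two Q-nodes are adjacent in 𝒯, and since 𝒯 is a tree, counting its
-- edges yields a non-Q node μ with at most one edge to another non-Q node.  μ is not an S-node:
-- two consecutive edges of its cycle would lead to Q-nodes, and the cycle vertex between them would
-- have degree 2 in G.  So μ is a P- or R-node; its skeleton has two distinct virtual edges, and one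
-- of them leads to a Q-node.

module Submission where

open import Defs
open import Axiom.UniquenessOfIdentityProofs using (module Decidable⇒UIP)
open import Data.Bool using (Bool; true; false; if_then_else_; _∧_; _∨_; not)
open import Data.Bool.Properties using (∧-zeroʳ; ∧-identityʳ; ∧-distribˡ-∨; ∨-zeroʳ)
open import Data.Empty using (⊥; ⊥-elim)
open import Data.Fin using (Fin; zero; suc; toℕ; fromℕ<)
open import Data.Fin.Properties using (_≟_; toℕ-fromℕ<; toℕ-injective; toℕ<n)
open import Data.Maybe using (Maybe; just; nothing)
open import Data.Maybe.Properties using (just-injective)
import Data.Maybe.Properties as Maybe
open import Data.Nat using (ℕ; zero; suc; _+_; _≤_; _<_; z≤n; s≤s; _<?_)
open import Data.Nat.Properties
  using ( +-0-commutativeMonoid; module ≤-Reasoning; ≤-refl; ≤-trans; ≤-antisym; ≤-pred; n≤1+n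
        ; m≤n+m; <⇒≱; ≤⇒≯; ≰⇒>; ≮⇒≥; +-comm; +-suc; +-identityʳ; +-mono-≤; +-monoʳ-≤; +-mono-<
        ; +-cancelʳ-≤; suc-injective)
open import Algebra.Properties.CommutativeMonoid.Sum +-0-commutativeMonoid
  using (sum; ∑-comm; ∑-distrib-+; sum-cong-≗)
open import Data.Product using (Σ; _×_; _,_; proj₁; proj₂; ∃-syntax)
open import Data.Sum using (_⊎_; inj₁; inj₂)
open import Function using (_∘_; case_of_)
open import Relation.Binary.Construct.Closure.ReflexiveTransitive using (Star; ε; _◅_)
open import Relation.Binary.Construct.Closure.Symmetric using (SymClosure; fwd; bwd)
open import Relation.Binary.PropositionalEquality
open import Relation.Nullary using (¬_; does; yes; no; contradiction)
open import Relation.Nullary.Decidable using (dec-true)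

ind : Bool → ℕ
ind b = if b then 1 else 0

ind-∨ : ∀ a b → ind (a ∨ b) ≤ ind a + ind b
ind-∨ true  _     = s≤s z≤n
ind-∨ false _     = ≤-refl

sum-mono-≤ : ∀ {n} {f g : Fin n → ℕ} → (∀ i → f i ≤ g i) → sum f ≤ sum g
sum-mono-≤ {zero}  f≤g = z≤n
sum-mono-≤ {suc n} f≤g = +-mono-≤ (f≤g zero) (sum-mono-≤ (f≤g ∘ suc))

sum-<⇒∃< : ∀ {n} (f g : Fin n → ℕ) → sum f < sum g → ∃[ i ] f i < g i
sum-<⇒∃< {zero}  f g ()
sum-<⇒∃< {suc n} f g ∑f<∑g with f zero <? g zero
... | yes f₀<g₀ = zero , f₀<g₀
... | no  f₀≮g₀ =
  let ∑f'<∑g' = ≰⇒> λ ∑g'≤∑f' → <⇒≱ ∑f<∑g (+-mono-≤ (≮⇒≥ f₀≮g₀) ∑g'≤∑f')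
      (i , fᵢ<gᵢ) = sum-<⇒∃< (f ∘ suc) (g ∘ suc) ∑f'<∑g'
  in suc i , fᵢ<gᵢ

count≡∑ind : ∀ {n} (p : Fin n → Bool) → count p ≡ sum (ind ∘ p)
count≡∑ind {zero}  p = refl
count≡∑ind {suc n} p = cong (ind (p zero) +_) (count≡∑ind (p ∘ suc))

count-zero : ∀ {n} (p : Fin n → Bool) → (∀ i → p i ≡ false) → count p ≡ 0
count-zero {zero}  p p≡false = refl
count-zero {suc n} p p≡false rewrite p≡false zero = count-zero (p ∘ suc) (p≡false ∘ suc)

count-mono : ∀ {n} (p q : Fin n → Bool) → (∀ i → p i ≡ true → q i ≡ true) → count p ≤ count q
count-mono p q p⇒q rewrite count≡∑ind p | count≡∑ind q = sum-mono-≤ ind-mono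
  where
  ind-mono : ∀ i → ind (p i) ≤ ind (q i)
  ind-mono i with p i in pᵢ
  ... | false = z≤n
  ... | true rewrite p⇒q i pᵢ = ≤-refl

count-∨ : ∀ {n} (p q : Fin n → Bool) → count (λ i → p i ∨ q i) ≤ count p + count q
count-∨ p q = begin
  count (λ i → p i ∨ q i)         ≡⟨ count≡∑ind (λ i → p i ∨ q i) ⟩
  sum (λ i → ind (p i ∨ q i))     ≤⟨ sum-mono-≤ (λ i → ind-∨ (p i) (q i)) ⟩
  sum (λ i → ind (p i) + ind (q i)) ≡⟨ ∑-distrib-+ (ind ∘ p) (ind ∘ q) ⟩
  sum (ind ∘ p) + sum (ind ∘ q)   ≡⟨ sym (cong₂ _+_ (count≡∑ind p) (count≡∑ind q)) ⟩
  count p + count q               ∎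
  where open ≤-Reasoning

count-at : ∀ {n} (p : Fin n → Bool) (a : Fin n) → count (λ i → p i ∧ does (a ≟ i)) ≡ ind (p a)
count-at {suc n} p zero
  rewrite ∧-identityʳ (p zero) | count-zero (λ i → p (suc i) ∧ false) (λ i → ∧-zeroʳ (p (suc i)))
  = +-identityʳ (ind (p zero))
count-at {suc n} p (suc a) rewrite ∧-zeroʳ (p zero) = count-at (p ∘ suc) a

count-complement : ∀ {n} (p : Fin n → Bool) → count p + count (not ∘ p) ≡ n
count-complement {zero}  p = refl
count-complement {suc n} p with p zero
... | true  = cong suc (count-complement (p ∘ suc))
... | false = trans (+-suc (count (p ∘ suc)) _) (cong suc (count-complement (p ∘ suc)))

count-pos : ∀ {n} (p : Fin n → Bool) i → p i ≡ true → 0 < count p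
count-pos p zero    pᵢ rewrite pᵢ = s≤s z≤n
count-pos p (suc i) pᵢ = ≤-trans (count-pos (p ∘ suc) i pᵢ) (m≤n+m _ (ind (p zero)))

count≤1⇒unique : ∀ {n} (p : Fin n → Bool) → count p ≤ 1 → ∀ i j → p i ≡ true → p j ≡ true → i ≡ j
count≤1⇒unique p c≤1 zero    zero    pᵢ pⱼ = refl
count≤1⇒unique p c≤1 zero    (suc j) pᵢ pⱼ rewrite pᵢ =
  contradiction (count-pos (p ∘ suc) j pⱼ) (≤⇒≯ (≤-pred c≤1))
count≤1⇒unique p c≤1 (suc i) zero    pᵢ pⱼ rewrite pⱼ =
  contradiction (count-pos (p ∘ suc) i pᵢ) (≤⇒≯ (≤-pred c≤1))
count≤1⇒unique p c≤1 (suc i) (suc j) pᵢ pⱼ =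
  cong suc (count≤1⇒unique (p ∘ suc) (≤-trans (m≤n+m _ (ind (p zero))) c≤1) i j pᵢ pⱼ)

count-⊆-pair : ∀ {n} (p : Fin n → Bool) (a b : Fin n) → (∀ i → p i ≡ true → a ≡ i ⊎ b ≡ i) → count p ≤ 2
count-⊆-pair p a b p⊆ab = begin
  count p                                          ≤⟨ count-mono p (λ i → does (a ≟ i) ∨ does (b ≟ i)) in-pair ⟩
  count (λ i → does (a ≟ i) ∨ does (b ≟ i))        ≤⟨ count-∨ (λ i → does (a ≟ i)) (λ i → does (b ≟ i)) ⟩
  count (λ i → does (a ≟ i)) + count (λ i → does (b ≟ i))
    ≡⟨ cong₂ _+_ (count-at (λ _ → true) a) (count-at (λ _ → true) b) ⟩
  2                                                ∎
  where
  open ≤-Reasoning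
  in-pair : ∀ i → p i ≡ true → (does (a ≟ i) ∨ does (b ≟ i)) ≡ true
  in-pair i pᵢ with p⊆ab i pᵢ
  ... | inj₁ a≡i rewrite dec-true (a ≟ i) a≡i = refl
  ... | inj₂ b≡i rewrite dec-true (b ≟ i) b≡i = ∨-zeroʳ _

_∈ᵖ_ : ∀ {A : Set} → A → A × A → Set
v ∈ᵖ p = proj₁ p ≡ v ⊎ proj₂ p ≡ v

SamePair-sym : ∀ {A : Set} {p q : A × A} → SamePair p q → SamePair q p
SamePair-sym (inj₁ (refl , refl)) = inj₁ (refl , refl)
SamePair-sym (inj₂ (refl , refl)) = inj₂ (refl , refl)

∈ᵖ-resp-SamePair : ∀ {A : Set} {p q : A × A} {v : A} → SamePair p q → v ∈ᵖ q → v ∈ᵖ p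
∈ᵖ-resp-SamePair (inj₁ (refl , refl)) v∈q        = v∈q
∈ᵖ-resp-SamePair (inj₂ (refl , refl)) (inj₁ eq) = inj₂ eq
∈ᵖ-resp-SamePair (inj₂ (refl , refl)) (inj₂ eq) = inj₁ eq

SamePair-swap : ∀ {A : Set} {p : A × A} {a b : A} → SamePair p (a , b) → SamePair p (b , a)
SamePair-swap (inj₁ (refl , refl)) = inj₂ (refl , refl)
SamePair-swap (inj₂ (refl , refl)) = inj₁ (refl , refl)

∈ᵖ-swap : ∀ {A : Set} {a b v : A} → v ∈ᵖ (a , b) → v ∈ᵖ (b , a)
∈ᵖ-swap (inj₁ a≡v) = inj₂ a≡v
∈ᵖ-swap (inj₂ b≡v) = inj₁ b≡v

SamePair-common : ∀ {A : Set} {p : A × A} {a b c : A} → SamePair p (a , b) → SamePair p (a , c) → c ∈ᵖ (a , b)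
SamePair-common p~ab p~ac = ∈ᵖ-resp-SamePair (SamePair-sym p~ab) (∈ᵖ-resp-SamePair p~ac (inj₂ refl))

Fin2-other : ∀ {n} → n ≡ 2 → (c : Fin n) → ∃[ a ] a ≢ c
Fin2-other refl zero       = suc zero , λ ()
Fin2-other refl (suc zero) = zero , λ ()

Fin2-≢-unique : ∀ {n} → n ≡ 2 → {a b c : Fin n} → a ≢ c → b ≢ c → a ≡ b
Fin2-≢-unique refl {zero}     {zero}     _   _   = refl
Fin2-≢-unique refl {suc zero} {suc zero} _   _   = refl
Fin2-≢-unique refl {zero}     {suc zero} {zero}     a≢c _   = contradiction refl a≢c
Fin2-≢-unique refl {zero}     {suc zero} {suc zero} _   b≢c = contradiction refl b≢c
Fin2-≢-unique refl {suc zero} {zero}     {zero}     _   b≢c = contradiction refl b≢c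
Fin2-≢-unique refl {suc zero} {zero}     {suc zero} a≢c _   = contradiction refl a≢c

three-distinct : ∀ {n} → 3 ≤ n → Σ (Fin n) λ a → Σ (Fin n) λ b → Σ (Fin n) λ c → a ≢ b × a ≢ c × b ≢ c
three-distinct {suc zero}       (s≤s ())
three-distinct {suc (suc zero)} (s≤s (s≤s ()))
three-distinct {suc (suc (suc n))} _ = zero , suc zero , suc (suc zero) , (λ ()) , (λ ()) , (λ ())

sucWrap-injective : ∀ {n} → Injective (sucWrap {n})
sucWrap-injective {suc n} i j eq with toℕ i <? n | toℕ j <? n
... | yes i<n | yes j<n = toℕ-injective (suc-injective (begin
  suc (toℕ i)                ≡⟨ cong suc (toℕ-fromℕ< i<n) ⟨
  suc (toℕ (fromℕ< i<n))     ≡⟨ cong toℕ eq ⟩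
  suc (toℕ (fromℕ< j<n))     ≡⟨ cong suc (toℕ-fromℕ< j<n) ⟩
  suc (toℕ j)                ∎))
  where open ≡-Reasoning
... | no i≮n  | no j≮n  = toℕ-injective (trans (last i i≮n) (sym (last j j≮n)))
  where
  last : ∀ (k : Fin (suc n)) → ¬ toℕ k < n → toℕ k ≡ n
  last k k≮n = ≤-antisym (≤-pred (toℕ<n k)) (≮⇒≥ k≮n)
sucWrap-injective {suc n} i j () | yes _ | no _
sucWrap-injective {suc n} i j () | no _  | yes _

AtMostOnce : ∀ {n} → (Fin n → Bool) → Set
AtMostOnce b = ∀ i j → b i ≡ true → b j ≡ true → i ≡ j

AtMostOnce⇒false : ∀ {n} {b : Fin n → Bool} {k} → AtMostOnce b → b k ≡ true → ∀ j → k ≢ j → b j ≡ false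
AtMostOnce⇒false {b = b} once bₖ j k≢j with b j in bⱼ
... | false = refl
... | true  = contradiction (once _ _ bₖ bⱼ) k≢j

∃-consecutive-false : ∀ {n} → 3 ≤ n → (b : Fin n → Bool) → AtMostOnce b
  → ∃[ i ] (b i ≡ false × b (sucWrap i) ≡ false)
∃-consecutive-false {suc zero}       (s≤s ())
∃-consecutive-false {suc (suc zero)} (s≤s (s≤s ()))
∃-consecutive-false {suc (suc (suc m))} _ b once with b zero in b₀ | b (suc zero) in b₁
... | false | false = zero , b₀ , b₁
... | true  | _     = suc zero , off (suc zero) (λ ()) , off (suc (suc zero)) (λ ())
  where off = AtMostOnce⇒false once b₀
... | false | true  = suc (suc zero) , off (suc (suc zero)) (λ ()) , off _ (1≢sucWrap2 m)
  where
  off = AtMostOnce⇒false once b₁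
  1≢sucWrap2 : ∀ m → suc zero ≢ sucWrap {suc (suc (suc m))} (suc (suc zero))
  1≢sucWrap2 zero    ()
  1≢sucWrap2 (suc m) ()

≢nothing⇒just : ∀ {A : Set} {m : Maybe A} → m ≢ nothing → ∃[ a ] m ≡ just a
≢nothing⇒just {m = just a}  _          = a , refl
≢nothing⇒just {m = nothing} m≢nothing = contradiction refl m≢nothing

module _ (T : MGraph) where

  incidentᵇ⇒Incident : ∀ e v → incidentᵇ T e v ≡ true → Incident T e v
  incidentᵇ⇒Incident e v h with proj₁ (ends T e) ≟ v | proj₂ (ends T e) ≟ v
  ... | yes e₁≡v | _         = inj₁ e₁≡v
  ... | no _     | yes e₂≡v  = inj₂ e₂≡v

  Incident⇒incidentᵇ : ∀ e v → Incident T e v → incidentᵇ T e v ≡ true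
  Incident⇒incidentᵇ e v (inj₁ e₁≡v) rewrite dec-true (proj₁ (ends T e) ≟ v) e₁≡v = refl
  Incident⇒incidentᵇ e v (inj₂ e₂≡v) rewrite dec-true (proj₂ (ends T e) ≟ v) e₂≡v = ∨-zeroʳ _

  count-incident-≤ : ∀ (p : Fin (nV T) → Bool) e →
    count (λ v → p v ∧ incidentᵇ T e v) ≤ ind (p (proj₁ (ends T e))) + ind (p (proj₂ (ends T e)))
  count-incident-≤ p e = begin
    count (λ v → p v ∧ (d₁ v ∨ d₂ v))                   ≤⟨ count-mono _ _ distrib ⟩
    count (λ v → (p v ∧ d₁ v) ∨ (p v ∧ d₂ v))           ≤⟨ count-∨ (λ v → p v ∧ d₁ v) (λ v → p v ∧ d₂ v) ⟩
    count (λ v → p v ∧ d₁ v) + count (λ v → p v ∧ d₂ v) ≡⟨ cong₂ _+_ (count-at p _) (count-at p _) ⟩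
    ind (p (proj₁ (ends T e))) + ind (p (proj₂ (ends T e))) ∎
    where
    open ≤-Reasoning
    d₁ d₂ : Fin (nV T) → Bool
    d₁ v = does (proj₁ (ends T e) ≟ v)
    d₂ v = does (proj₂ (ends T e) ≟ v)
    distrib : ∀ v → p v ∧ (d₁ v ∨ d₂ v) ≡ true → (p v ∧ d₁ v) ∨ (p v ∧ d₂ v) ≡ true
    distrib v h = trans (sym (∧-distribˡ-∨ (p v) (d₁ v) (d₂ v))) h

  ∑-count-incident-comm : (r : Fin (nE T) → Fin (nV T) → Bool) →
    sum (λ v → count (λ e → r e v ∧ incidentᵇ T e v)) ≡ sum (λ e → count (λ v → r e v ∧ incidentᵇ T e v))
  ∑-count-incident-comm r = begin
    sum (λ v → count (λ e → r e v ∧ incidentᵇ T e v))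
      ≡⟨ sum-cong-≗ (λ v → count≡∑ind (λ e → r e v ∧ incidentᵇ T e v)) ⟩
    sum (λ v → sum (λ e → ind (r e v ∧ incidentᵇ T e v)))
      ≡⟨ ∑-comm (λ v e → ind (r e v ∧ incidentᵇ T e v)) ⟩
    sum (λ e → sum (λ v → ind (r e v ∧ incidentᵇ T e v)))
      ≡⟨ sum-cong-≗ (λ e → sym (count≡∑ind (λ v → r e v ∧ incidentᵇ T e v))) ⟩
    sum (λ e → count (λ v → r e v ∧ incidentᵇ T e v)) ∎
    where open ≡-Reasoning

module _ (H : MGraph) (π : Fin (nV H) → Fin (nV H)) (π-injective : Injective π)
         (τ : Fin (nV H) → Fin (nE H)) (τ-surjective : ∀ e → ∃[ j ] τ j ≡ e)
         (τ-ends : ∀ i → SamePair (ends H (τ i)) (π i , π (sucWrap i))) where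

  cycle-edges-at : ∀ i e → Incident H e (π (sucWrap i)) → τ i ≡ e ⊎ τ (sucWrap i) ≡ e
  cycle-edges-at i e e∋x with τ-surjective e
  ... | j , refl with ∈ᵖ-resp-SamePair (SamePair-sym (τ-ends j)) e∋x
  ...   | inj₁ πj≡x  = inj₂ (cong τ (sym (π-injective _ _ πj≡x)))
  ...   | inj₂ πj'≡x = inj₁ (cong τ (sym (sucWrap-injective _ _ (π-injective _ _ πj'≡x))))

module _ (H : MGraph) where

  edge-at-start : ∀ {u v} → u ≢ v → Reach H (λ _ → ⊥) u v → ∃[ e ] ∃[ w ] SamePair (ends H e) (u , w)
  edge-at-start u≢v here                  = contradiction refl u≢v
  edge-at-start u≢v (step (e , e~uw) _ _) = e , _ , e~uw

  -- Take an edge at a towards b, ending at w say, and then an edge at a vertex z ∉ {a, w}.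
  connected⇒two-edges : 3 ≤ nV H → Connected H → ∃[ e ] ∃[ e' ] e ≢ e'
  connected⇒two-edges 3≤n conn with three-distinct 3≤n
  ... | a , b , c , a≢b , a≢c , b≢c with edge-at-start a≢b (conn a b (λ ()) (λ ()))
  ...   | e , w , e~aw with avoid w
    where
    avoid : ∀ w → ∃[ z ] (a ≢ z × w ≢ z)
    avoid w with w ≟ b
    ... | yes refl = c , a≢c , b≢c
    ... | no  w≢b  = b , a≢b , w≢b
  ...     | z , a≢z , w≢z with edge-at-start (λ z≡a → a≢z (sym z≡a)) (conn z a (λ ()) (λ ()))
  ...       | e' , _ , e'~zw' = e , e' , e≢e'
    where
    e≢e' : e ≢ e'
    e≢e' refl with ∈ᵖ-resp-SamePair (SamePair-sym e~aw) (∈ᵖ-resp-SamePair e'~zw' (inj₁ refl))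
    ... | inj₁ a≡z = a≢z a≡z
    ... | inj₂ w≡z = w≢z w≡z

ind-∧≡false : ∀ a b → a ∧ b ≡ false → ind a + ind b ≤ ind (not (not a ∧ not b))
ind-∧≡false true  false _ = ≤-refl
ind-∧≡false false true  _ = ≤-refl
ind-∧≡false false false _ = z≤n

ind-∧-both : ∀ a b → ind (a ∧ (a ∧ b)) + ind (b ∧ (a ∧ b)) ≤ ind (a ∧ b) + ind (a ∧ b)
ind-∧-both true  true  = ≤-refl
ind-∧-both true  false = ≤-refl
ind-∧-both false true  = ≤-refl
ind-∧-both false false = ≤-refl

module _ (T : MGraph) (marked : Fin (nV T) → Bool) where

  unmarked : Fin (nV T) → Bool
  unmarked = not ∘ marked

  inner : Fin (nE T) → Bool
  inner e = unmarked (proj₁ (ends T e)) ∧ unmarked (proj₂ (ends T e))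

  outer⇒marked-end : ∀ e → inner e ≡ false → marked (proj₁ (ends T e)) ≡ true ⊎ marked (proj₂ (ends T e)) ≡ true
  outer⇒marked-end e outer with marked (proj₁ (ends T e)) | marked (proj₂ (ends T e))
  ... | true  | _     = inj₁ refl
  ... | false | true  = inj₂ refl
  outer⇒marked-end e () | false | false

  innerDegree : Fin (nV T) → ℕ
  innerDegree v = count (λ e → inner e ∧ incidentᵇ T e v)

  count-marked≤count-outer : (∀ v → marked v ≡ true → 0 < degree T v)
    → (∀ e → marked (proj₁ (ends T e)) ∧ marked (proj₂ (ends T e)) ≡ false)
    → count marked ≤ count (not ∘ inner)
  count-marked≤count-outer marked⇒deg>0 no-marked-edge = begin
    count marked                                           ≡⟨ count≡∑ind marked ⟩
    sum (ind ∘ marked)                                     ≤⟨ sum-mono-≤ ind≤degree ⟩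
    sum (λ v → count (λ e → marked v ∧ incidentᵇ T e v))   ≡⟨ ∑-count-incident-comm T (λ _ v → marked v) ⟩
    sum (λ e → count (λ v → marked v ∧ incidentᵇ T e v))   ≤⟨ sum-mono-≤ ≤ind-outer ⟩
    sum (ind ∘ (not ∘ inner))                              ≡⟨ count≡∑ind (not ∘ inner) ⟨
    count (not ∘ inner)                                    ∎
    where
    open ≤-Reasoning
    ind≤degree : ∀ v → ind (marked v) ≤ count (λ e → marked v ∧ incidentᵇ T e v)
    ind≤degree v with marked v in m
    ... | true  = marked⇒deg>0 v m
    ... | false = z≤n
    ≤ind-outer : ∀ e → count (λ v → marked v ∧ incidentᵇ T e v) ≤ ind (not (inner e))
    ≤ind-outer e = ≤-trans (count-incident-≤ T marked e)
                           (ind-∧≡false (marked (proj₁ (ends T e))) _ (no-marked-edge e))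

  ∑innerDegree≤2·count-inner : sum (λ v → count (λ e → (unmarked v ∧ inner e) ∧ incidentᵇ T e v))
                             ≤ count inner + count inner
  ∑innerDegree≤2·count-inner = begin
    sum (λ v → count (λ e → (unmarked v ∧ inner e) ∧ incidentᵇ T e v))
      ≡⟨ ∑-count-incident-comm T (λ e v → unmarked v ∧ inner e) ⟩
    sum (λ e → count (λ v → (unmarked v ∧ inner e) ∧ incidentᵇ T e v))
      ≤⟨ sum-mono-≤ ≤2·ind-inner ⟩
    sum (λ e → ind (inner e) + ind (inner e))
      ≡⟨ ∑-distrib-+ (ind ∘ inner) (ind ∘ inner) ⟩
    sum (ind ∘ inner) + sum (ind ∘ inner)
      ≡⟨ cong₂ _+_ (count≡∑ind inner) (count≡∑ind inner) ⟨
    count inner + count inner ∎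
    where
    open ≤-Reasoning
    ≤2·ind-inner : ∀ e → count (λ v → (unmarked v ∧ inner e) ∧ incidentᵇ T e v) ≤ ind (inner e) + ind (inner e)
    ≤2·ind-inner e = ≤-trans (count-incident-≤ T (λ v → unmarked v ∧ inner e) e)
                             (ind-∧-both (unmarked (proj₁ (ends T e))) (unmarked (proj₂ (ends T e))))

  -- Each edge has at most one marked end, so there are at least as many outer edges as marked
  -- vertices; as |E| = |V| − 1 there are fewer inner edges than unmarked vertices, and the inner
  -- degrees of the unmarked vertices, which sum to twice the number of inner edges, average below 2.
  ∃-unmarked-innerDegree≤1 : suc (nE T) ≡ nV T
    → (∀ v → marked v ≡ true → 0 < degree T v)
    → (∀ e → marked (proj₁ (ends T e)) ∧ marked (proj₂ (ends T e)) ≡ false)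
    → ∃[ μ ] (marked μ ≡ false × innerDegree μ ≤ 1)
  ∃-unmarked-innerDegree≤1 tree marked⇒deg>0 no-marked-edge
      with sum-<⇒∃< _ (λ v → ind (unmarked v) + ind (unmarked v)) (begin-strict
        _                                           ≤⟨ ∑innerDegree≤2·count-inner ⟩
        count inner + count inner                   <⟨ +-mono-< inner<unmarked inner<unmarked ⟩
        count unmarked + count unmarked             ≡⟨ cong₂ _+_ (count≡∑ind unmarked) (count≡∑ind unmarked) ⟩
        sum (ind ∘ unmarked) + sum (ind ∘ unmarked) ≡⟨ ∑-distrib-+ (ind ∘ unmarked) (ind ∘ unmarked) ⟨
        sum (λ v → ind (unmarked v) + ind (unmarked v)) ∎)
    where
    open ≤-Reasoning
    inner<unmarked : count inner < count unmarked
    inner<unmarked = +-cancelʳ-≤ (count marked) (suc (count inner)) (count unmarked) (begin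
      suc (count inner + count marked)
        ≤⟨ s≤s (+-monoʳ-≤ (count inner) (count-marked≤count-outer marked⇒deg>0 no-marked-edge)) ⟩
      suc (count inner + count (not ∘ inner)) ≡⟨ cong suc (count-complement inner) ⟩
      suc (nE T)                              ≡⟨ tree ⟩
      nV T                                    ≡⟨ count-complement marked ⟨
      count marked + count unmarked           ≡⟨ +-comm (count marked) _ ⟩
      count unmarked + count marked           ∎)
  ... | μ , low with marked μ in m
  ...   | false = μ , m , ≤-pred low

isQ : NodeType → Bool
isQ Q = true
isQ _ = false

isQ⇒≡Q : ∀ t → isQ t ≡ true → t ≡ Q
isQ⇒≡Q Q _ = refl

module SPQR {G : MGraph} {D : Decomp G} (spqr : IsSPQRTree D) where
  open Decomp D
  open IsSPQRTree spqr

  rmap-cong : ∀ {μ e e'} → e ≡ e' → (p : kind μ e ≡ nothing) (p' : kind μ e' ≡ nothing)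
            → rmap μ e p ≡ rmap μ e' p'
  rmap-cong refl p p' = cong (rmap _ _) (Decidable⇒UIP.≡-irrelevant (Maybe.≡-dec _≟_) p p')

  module _ {q : Node D} (q-Q : type q ≡ Q) where

    Q-skeleton : nV (skel q) ≡ 2 × nE (skel q) ≡ 2 × Loopless (skel q)
               × ∃[ r ] (kind q r ≡ nothing × (∀ e → kind q e ≡ nothing → e ≡ r))
    Q-skeleton = subst (SkelOK D q) q-Q (skelOK q)

    Q-vertex : Fin (nV (skel q))
    Q-vertex = subst Fin (sym (proj₁ Q-skeleton)) zero

    Q-virtual-edge : ∃[ e ] ∃[ τ ] kind q e ≡ just τ
    Q-virtual-edge with Q-skeleton
    ... | _ , two , _ , r , _ , r-unique with Fin2-other two r
    ...   | e , e≢r with kind q e in k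
    ...     | just τ  = e , τ , k
    ...     | nothing = contradiction (r-unique e k) e≢r

    Q-single-tree-edge : ∀ {e e' τ τ'} → kind q e ≡ just τ → kind q e' ≡ just τ' → τ ≡ τ'
    Q-single-tree-edge {e} {e'} k k' with Q-skeleton
    ... | _ , two , _ , r , r-real , _ = just-injective (begin
      just _         ≡⟨ k ⟨
      kind q e       ≡⟨ cong (kind q) (Fin2-≢-unique two (virtual≢r k) (virtual≢r k')) ⟩
      kind q e'      ≡⟨ k' ⟩
      just _         ∎)
      where
      open ≡-Reasoning
      virtual≢r : ∀ {x t} → kind q x ≡ just t → x ≢ r
      virtual≢r kx refl with trans (sym kx) r-real
      ... | ()

    Q-single-real-edge : ∃[ g ] (∀ e p → g ≡ rmap q e p)
    Q-single-real-edge with Q-skeleton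
    ... | _ , _ , _ , r , r-real , r-unique = rmap q r r-real , λ e p → rmap-cong (sym (r-unique e p)) r-real p

    Q-degree>0 : 0 < degree tree q
    Q-degree>0 with Q-virtual-edge
    ... | e , τ , k = count-pos _ τ (Incident⇒incidentᵇ tree τ q (kindInc q e τ k))

  LeavesAlong : SkelVertex D → Node D → Set
  LeavesAlong (μ , x) ν = ∃[ τ ] ∃[ e ] (kind μ e ≡ just τ × Incident (skel μ) e x × SamePair (ends tree τ) (μ , ν))

  glue-step : ∀ b c → SymClosure (Glue D) b c → vmap' D b ≡ vmap' D c × LeavesAlong b (proj₁ c)
  glue-step _ _ (fwd (τ , refl , e , _ , k , _ , x∈e , _ , x≡y)) = x≡y , τ , e , k , x∈e , inj₁ (refl , refl)
  glue-step _ _ (bwd (τ , refl , _ , e , _ , k , _ , x∈e , y≡x)) = sym y≡x , τ , e , k , x∈e , inj₂ (refl , refl)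

  ClosedAt : Fin (nV G) → (Node D → Set) → Set
  ClosedAt v N = ∀ b ν → vmap' D b ≡ v → N (proj₁ b) → LeavesAlong b ν → N ν

  copies-in-closed : ∀ {v N} → ClosedAt v N → ∀ a → vmap' D a ≡ v → N (proj₁ a)
                   → ∀ b → vmap' D b ≡ v → N (proj₁ b)
  copies-in-closed {v} {N} closed a aᵥ Nₐ b bᵥ = walk (vmapGlue a b (trans aᵥ (sym bᵥ))) aᵥ Nₐ
    where
    walk : ∀ {c d} → Star (SymClosure (Glue D)) c d → vmap' D c ≡ v → N (proj₁ c) → N (proj₁ d)
    walk ε                           _  N꜀ = N꜀
    walk {c} {d} (_◅_ {j = j} c~j j⋯d) cᵥ N꜀ with glue-step c j c~j
    ... | c≡j , leaves = walk j⋯d (trans (sym c≡j) cᵥ) (closed c (proj₁ j) cᵥ N꜀ leaves)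

  -- Every edge of G at v is a real skeleton edge at a copy of v, and all copies of v lie in N.
  closed-degree≤2 : ∀ {v N} → ClosedAt v N → ∀ a → vmap' D a ≡ v → N (proj₁ a)
    → ∀ g₁ g₂ → (∀ ν e p → N ν → g₁ ≡ rmap ν e p ⊎ g₂ ≡ rmap ν e p) → degree G v ≤ 2
  closed-degree≤2 {v} {N} closed a aᵥ Nₐ g₁ g₂ real-in = count-⊆-pair _ g₁ g₂ edge-at-v
    where
    edge-at-v : ∀ g → incidentᵇ G g v ≡ true → g₁ ≡ g ⊎ g₂ ≡ g
    edge-at-v g g∋v with realSurj g
    ... | ν , e , p , refl = real-in ν e p (copy-in-N (∈ᵖ-resp-SamePair (realEnds ν e p) (incidentᵇ⇒Incident G g v g∋v)))
      where
      copy-in-N : v ∈ᵖ vends D ν e → N ν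
      copy-in-N (inj₁ xᵥ) = copies-in-closed closed a aᵥ Nₐ (ν , _) xᵥ
      copy-in-N (inj₂ yᵥ) = copies-in-closed closed a aᵥ Nₐ (ν , _) yᵥ

  Q-leaves-along-its-edge : ∀ {q m t x ν} → type q ≡ Q → SamePair (ends tree t) (q , m)
                          → LeavesAlong (q , x) ν → ν ∈ᵖ (q , m)
  Q-leaves-along-its-edge {q} {t = t} q-Q t~qm (τ , e , k , _ , τ~qν)
      with kindUnique t q (∈ᵖ-resp-SamePair t~qm (inj₁ refl))
  ... | e₁ , k₁ , _ with Q-single-tree-edge q-Q k k₁
  ...   | refl = SamePair-common t~qm τ~qν

  marked : Node D → Bool
  marked μ = isQ (type μ)

  marked⇒degree>0 : ∀ q → marked q ≡ true → 0 < degree tree q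
  marked⇒degree>0 q m = Q-degree>0 (isQ⇒≡Q _ m)

  outer-edge⇒Q-neighbour : ∀ {μ τ} → marked μ ≡ false → Incident tree τ μ → inner tree marked τ ≡ false
    → ∃[ q ] (type q ≡ Q × SamePair (ends tree τ) (q , μ))
  outer-edge⇒Q-neighbour {τ = τ} μ-unmarked τ∋μ outer with τ∋μ | outer⇒marked-end tree marked τ outer
  ... | inj₁ e₁≡μ | inj₂ m₂ = _ , isQ⇒≡Q _ m₂ , inj₂ (e₁≡μ , refl)
  ... | inj₂ e₂≡μ | inj₁ m₁ = _ , isQ⇒≡Q _ m₁ , inj₁ (refl , e₂≡μ)
  ... | inj₁ refl | inj₁ m₁ = case trans (sym m₁) μ-unmarked of λ ()
  ... | inj₂ refl | inj₂ m₂ = case trans (sym m₂) μ-unmarked of λ ()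

  same-virtual-edge-same-end : ∀ {μ e τ τ′ ν q} → kind μ e ≡ just τ → kind μ e ≡ just τ′
    → SamePair (ends tree τ) (μ , ν) → SamePair (ends tree τ′) (q , μ) → ν ∈ᵖ (q , μ)
  same-virtual-edge-same-end k k′ τ~μν τ′~qμ with just-injective (trans (sym k) k′)
  ... | refl = ∈ᵖ-swap (SamePair-common (SamePair-swap τ′~qμ) τ~μν)

  kind-just-injective : ∀ {μ e e' τ} → kind μ e ≡ just τ → kind μ e' ≡ just τ → e ≡ e'
  kind-just-injective {μ} {e} {e'} {τ} k k' with kindUnique τ μ (kindInc μ e τ k)
  ... | _ , _ , unique = trans (unique e k) (sym (unique e' k'))

  module _ {μ : Node D} (all-virtual : AllVirtual D μ) where

    treeEdge : Fin (nE (skel μ)) → Fin (nE tree)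
    treeEdge e = proj₁ (≢nothing⇒just (all-virtual e))

    kind≡treeEdge : ∀ e → kind μ e ≡ just (treeEdge e)
    kind≡treeEdge e = proj₂ (≢nothing⇒just (all-virtual e))

    treeEdge-injective : Injective treeEdge
    treeEdge-injective e e' eq = kind-just-injective (kind≡treeEdge e) (trans (kind≡treeEdge e') (cong just (sym eq)))

    treeEdge-at : ∀ e → Incident tree (treeEdge e) μ
    treeEdge-at e = kindInc μ e _ (kind≡treeEdge e)

    innerAt : Fin (nE (skel μ)) → Bool
    innerAt e = inner tree marked (treeEdge e)

    innerAt-AtMostOnce : innerDegree tree marked μ ≤ 1 → AtMostOnce innerAt
    innerAt-AtMostOnce leaf e e' i i' = treeEdge-injective e e'
      (count≤1⇒unique _ leaf _ _ (at-μ e i) (at-μ e' i'))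
      where
      at-μ : ∀ e → innerAt e ≡ true → (innerAt e ∧ incidentᵇ tree (treeEdge e) μ) ≡ true
      at-μ e i rewrite i = Incident⇒incidentᵇ tree _ μ (treeEdge-at e)

    outerAt⇒Q-neighbour : marked μ ≡ false → ∀ e → innerAt e ≡ false → ∃[ q ] (type q ≡ Q × Adjacent tree q μ)
    outerAt⇒Q-neighbour μ-unmarked e outer with outer-edge⇒Q-neighbour μ-unmarked (treeEdge-at e) outer
    ... | q , q-Q , τ~qμ = q , q-Q , treeEdge e , τ~qμ

    Q-neighbour : marked μ ≡ false → innerDegree tree marked μ ≤ 1
                → ∀ {e e'} → e ≢ e' → ∃[ q ] (type q ≡ Q × Adjacent tree q μ)
    Q-neighbour μ-unmarked leaf {e} {e'} e≢e' with innerAt e in i | innerAt e' in i'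
    ... | false | _     = outerAt⇒Q-neighbour μ-unmarked e i
    ... | true  | false = outerAt⇒Q-neighbour μ-unmarked e' i'
    ... | true  | true  = contradiction (innerAt-AtMostOnce leaf e e' i i') e≢e'

  module MinDegree3 (deg≥3 : ∀ v → 3 ≤ degree G v) where

    ¬closed-with-two-real-edges : ∀ {N} a → ClosedAt (vmap' D a) N → N (proj₁ a)
      → ∀ g₁ g₂ → (∀ ν e p → N ν → g₁ ≡ rmap ν e p ⊎ g₂ ≡ rmap ν e p) → ⊥
    ¬closed-with-two-real-edges a closed Nₐ g₁ g₂ real-in =
      <⇒≱ (deg≥3 _) (closed-degree≤2 closed a refl Nₐ g₁ g₂ real-in)

    no-adjacent-Q-nodes : ∀ t → type (proj₁ (ends tree t)) ≡ Q → type (proj₂ (ends tree t)) ≡ Q → ⊥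
    no-adjacent-Q-nodes t q₁-Q q₂-Q with Q-single-real-edge q₁-Q | Q-single-real-edge q₂-Q
    ... | g₁ , g₁-only | g₂ , g₂-only =
      ¬closed-with-two-real-edges (q₁ , Q-vertex q₁-Q) closed (inj₁ refl) g₁ g₂ real-in
      where
      q₁ = proj₁ (ends tree t)
      q₂ = proj₂ (ends tree t)
      closed : ClosedAt _ (_∈ᵖ (q₁ , q₂))
      closed (_ , x) ν _ (inj₁ refl) leaves = Q-leaves-along-its-edge q₁-Q (inj₁ (refl , refl)) leaves
      closed (_ , x) ν _ (inj₂ refl) leaves with Q-leaves-along-its-edge q₂-Q (inj₂ (refl , refl)) leaves
      ... | inj₁ q₂≡ν = inj₂ q₂≡ν
      ... | inj₂ q₁≡ν = inj₁ q₁≡ν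
      real-in : ∀ ν e p → ν ∈ᵖ (q₁ , q₂) → g₁ ≡ rmap ν e p ⊎ g₂ ≡ rmap ν e p
      real-in ν e p (inj₁ refl) = inj₁ (g₁-only e p)
      real-in ν e p (inj₂ refl) = inj₂ (g₂-only e p)

    no-marked-edge : ∀ t → marked (proj₁ (ends tree t)) ∧ marked (proj₂ (ends tree t)) ≡ false
    no-marked-edge t with marked (proj₁ (ends tree t)) in m₁ | marked (proj₂ (ends tree t)) in m₂
    ... | true  | true  = ⊥-elim (no-adjacent-Q-nodes t (isQ⇒≡Q _ m₁) (isQ⇒≡Q _ m₂))
    ... | true  | false = refl
    ... | false | _     = refl

    S-node-innerDegree>1 : ∀ {μ} → type μ ≡ S → ¬ innerDegree tree marked μ ≤ 1
    S-node-innerDegree>1 {μ} μ-S leaf with subst (SkelOK D μ) μ-S (skelOK μ)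
    ... | (3≤k , π , (π-injective , _) , τ , (τ-injective , τ-surjective) , τ-ends) , all-virtual
        with ∃-consecutive-false 3≤k (innerAt all-virtual ∘ τ)
               (λ i j iᵢ iⱼ → τ-injective i j (innerAt-AtMostOnce all-virtual leaf _ _ iᵢ iⱼ))
    ... | i , outer₁ , outer₂
        with outer-edge⇒Q-neighbour (cong isQ μ-S) (treeEdge-at all-virtual (τ i)) outer₁
           | outer-edge⇒Q-neighbour (cong isQ μ-S) (treeEdge-at all-virtual (τ (sucWrap i))) outer₂
    ... | q₁ , q₁-Q , t₁~q₁μ | q₂ , q₂-Q , t₂~q₂μ with Q-single-real-edge q₁-Q | Q-single-real-edge q₂-Q
    ... | g₁ , g₁-only | g₂ , g₂-only = ¬closed-with-two-real-edges (μ , x) closed (inj₁ refl) g₁ g₂ real-in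
      where
      x = π (sucWrap i)
      N : Node D → Set
      N ν = μ ≡ ν ⊎ q₁ ≡ ν ⊎ q₂ ≡ ν
      via-q₁ : ∀ {ν} → ν ∈ᵖ (q₁ , μ) → N ν
      via-q₁ (inj₁ q₁≡ν) = inj₂ (inj₁ q₁≡ν)
      via-q₁ (inj₂ μ≡ν)  = inj₁ μ≡ν
      via-q₂ : ∀ {ν} → ν ∈ᵖ (q₂ , μ) → N ν
      via-q₂ (inj₁ q₂≡ν) = inj₂ (inj₂ q₂≡ν)
      via-q₂ (inj₂ μ≡ν)  = inj₁ μ≡ν
      closed : ClosedAt (vmap μ x) N
      closed (_ , y) ν yᵥ (inj₁ refl) (τ′ , e , k , e∋y , τ~μν) with vmapInj μ y x yᵥ
      ... | refl with cycle-edges-at (skel μ) π π-injective τ τ-surjective τ-ends i e e∋y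
      ...   | inj₁ refl = via-q₁ (same-virtual-edge-same-end k (kind≡treeEdge all-virtual e) τ~μν t₁~q₁μ)
      ...   | inj₂ refl = via-q₂ (same-virtual-edge-same-end k (kind≡treeEdge all-virtual e) τ~μν t₂~q₂μ)
      closed _ ν _ (inj₂ (inj₁ refl)) leaves = via-q₁ (Q-leaves-along-its-edge q₁-Q t₁~q₁μ leaves)
      closed _ ν _ (inj₂ (inj₂ refl)) leaves = via-q₂ (Q-leaves-along-its-edge q₂-Q t₂~q₂μ leaves)
      real-in : ∀ ν e p → N ν → g₁ ≡ rmap ν e p ⊎ g₂ ≡ rmap ν e p
      real-in ν e p (inj₁ refl)        = contradiction p (all-virtual e)
      real-in ν e p (inj₂ (inj₁ refl)) = inj₁ (g₁-only e p)
      real-in ν e p (inj₂ (inj₂ refl)) = inj₂ (g₂-only e p)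

lemma2 : (G : MGraph) → Simple G → Planar G → Biconnected G
         → (∀ v → 3 ≤ degree G v)
         → (D : Decomp G) → IsSPQRTree D
         → ∃[ μ ] ∃[ ν ] (Decomp.type D μ ≡ Q × Adjacent (Decomp.tree D) μ ν
                          × (Decomp.type D ν ≡ P ⊎ Decomp.type D ν ≡ R))
lemma2 G _ _ _ deg≥3 D spqr = Q-node-next-to-P-or-R-node
  where
  open Decomp D
  open IsSPQRTree spqr
  open SPQR spqr
  open MinDegree3 deg≥3

  Q-node-next-to-P-or-R-node : ∃[ μ ] ∃[ ν ] (type μ ≡ Q × Adjacent tree μ ν × (type ν ≡ P ⊎ type ν ≡ R))
  Q-node-next-to-P-or-R-node
      with ∃-unmarked-innerDegree≤1 tree marked treeEdges marked⇒degree>0 no-marked-edge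
  ... | μ , μ-unmarked , leaf with type μ in μ-type | skelOK μ
  ... | Q | _ = case μ-unmarked of λ ()
  ... | S | _ = contradiction leaf (S-node-innerDegree>1 μ-type)
  ... | P | (_ , 3≤edges , _ , all-virtual) =
    let (a , b , _ , a≢b , _) = three-distinct 3≤edges
        (q , q-Q , q~μ) = Q-neighbour all-virtual (cong isQ μ-type) leaf a≢b
    in q , μ , q-Q , q~μ , inj₁ μ-type
  ... | R | ((4≤n , _ , connected , _) , all-virtual) =
    let (a , b , a≢b) = connected⇒two-edges (skel μ) (≤-trans (n≤1+n 3) 4≤n) connected
        (q , q-Q , q~μ) = Q-neighbour all-virtual (cong isQ μ-type) leaf a≢b
    in q , μ , q-Q , q~μ , inj₂ μ-type
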